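{- Let $\mathcal A=\langle A;\Xi\rangle$ be an algebra, $\preceq$ an $\mathcal A$-stable preorder and $L\subseteq A$ a $\preceq$-initial segment (i.e. $a\in L$ and $b\preceq a$ imply $b\in L$). Then every set in $\mathrm{Latt}^{\infty}_{\mathcal A}(L)$ is a $\preceq$-initial segment.
   Context: An algebra $\mathcal A=\langle A;\Xi\rangle$ is a nonempty set with operations; an $\mathcal A$-stable preorder is a reflexive transitive relation compatible with every operation (arguments pairwise related imply values related). The 1-freezifications of an operation $\xi$ of arity $n\ge2$ are the maps $x\mapsto\xi(c_1,\dots,c_{i-1},x,c_{i+1},\dots,c_n)$ with $c_j\in A$; a unary operation is its own 1-freezification. $\mathrm{Freez}^*(\mathcal A)$ is the set of finite (possibly empty) compositions of 1-freezifications. $\mathrm{Latt}^{\infty}_{\mathcal A}(L)$ is the smallest family of subsets of $A$ containing $L$ and closed under arbitrary (including empty) unions and intersections and under $X\mapsto\gamma^{ -1}(X)$ for all $\gamma\in\mathrm{Freez}^*(\mathcal A)$. -}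

module Defs where

open import Level using (Level; _⊔_; suc)
open import Data.Nat using (ℕ)
open import Data.Fin using (Fin)
open import Data.Product using (Σ)
open import Data.Vec.Functional using (Vector; updateAt)
open import Function using (id; _∘_; const)
open import Relation.Unary using (Pred)

record Algebra (a o : Level) : Set (suc (a ⊔ o)) where
  field
    Carrier  : Set a
    inhabited : Carrier
    Op       : Set o
    arity    : Op → ℕ
    op       : (ξ : Op) → Vector Carrier (arity ξ) → Carrier

module _ {a o : Level} (𝒜 : Algebra a o) where
  open Algebra 𝒜

  record IsStablePreorder {r : Level} (_≼_ : Carrier → Carrier → Set r)
      : Set (a ⊔ o ⊔ r) where
    field
      refl≼   : ∀ x → x ≼ x
      trans≼  : ∀ {x y z} → x ≼ y → y ≼ z → x ≼ z
      compat  : ∀ (ξ : Op) (xs ys : Vector Carrier (arity ξ)) →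
                (∀ i → xs i ≼ ys i) → op ξ xs ≼ op ξ ys

  -- the 1-freezification of ξ at position i with frozen arguments c:
  --   x ↦ ξ(c₁,…,c_{i-1},x,c_{i+1},…,c_n).
  -- For a unary ξ this is ξ itself; nullary operations have none.
  freeze : (ξ : Op) → Fin (arity ξ) → Vector Carrier (arity ξ) →
           Carrier → Carrier
  freeze ξ i c x = op ξ (updateAt c i (const x))

  data Freez* : (Carrier → Carrier) → Set (a ⊔ o) where
    idF   : Freez* id
    compF : ∀ {g} (ξ : Op) (i : Fin (arity ξ)) (c : Vector Carrier (arity ξ)) →
            Freez* g → Freez* (freeze ξ i c ∘ g)

  -- Latt^∞_𝒜(L): smallest family of subsets (as predicates of level ℓ) containing L,
  -- closed under arbitrary (incl. empty) unions and intersections of families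
  -- indexed by types of level ℓ, under preimages by Freez*, and under
  -- extensional equality of subsets.
  data Latt∞ {ℓ : Level} (L : Pred Carrier ℓ) : Pred (Pred Carrier ℓ) (a ⊔ o ⊔ suc ℓ) where
    base  : Latt∞ L L
    ⋃-cl  : (I : Set ℓ) (F : I → Pred Carrier ℓ) → (∀ i → Latt∞ L (F i)) →
            Latt∞ L (λ x → Σ I (λ i → F i x))
    ⋂-cl  : (I : Set ℓ) (F : I → Pred Carrier ℓ) → (∀ i → Latt∞ L (F i)) →
            Latt∞ L (λ x → ∀ i → F i x)
    pre   : ∀ {X} {γ} → Freez* γ → Latt∞ L X → Latt∞ L (X ∘ γ)
    ext   : ∀ {X Y} → Latt∞ L X → (∀ x → X x → Y x) → (∀ x → Y x → X x) →
            Latt∞ L Y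

  IsInitial : ∀ {r ℓ} → (Carrier → Carrier → Set r) → Pred Carrier ℓ → Set (a ⊔ r ⊔ ℓ)
  IsInitial _≼_ L = ∀ {x y} → L x → y ≼ x → L y

{-# OPTIONS --safe #-}
module Submission where

open import Defs
open import Level using (Level)
open import Relation.Unary using (Pred)
open import Relation.Binary using (Rel; Reflexive)
open import Data.Fin using (Fin; zero; suc)
open import Data.Product using (_,_)
open import Data.Vec.Functional using (Vector; updateAt; tail)
open import Function using (_∘_)

-- Each freezification is monotone (stability at a single argument, the others
-- related by reflexivity), so preimages of initial segments under Freez* are
-- initial; unions and intersections of initial segments are initial, and
-- induction on Latt∞ finishes the proof.

updateAt-pointwise : ∀ {a r} {A : Set a} (R : Rel A r) → Reflexive R →
                     ∀ {n} (c : Vector A n) (i : Fin n) {f g : A → A} →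
                     R (f (c i)) (g (c i)) →
                     ∀ j → R (updateAt c i f j) (updateAt c i g j)
updateAt-pointwise R refl c zero    p zero    = p
updateAt-pointwise R refl c zero    p (suc j) = refl
updateAt-pointwise R refl c (suc i) p zero    = refl
updateAt-pointwise R refl c (suc i) p (suc j) = updateAt-pointwise R refl (tail c) i p j

module _ {a o r ℓ : Level} (𝒜 : Algebra a o)
         {_≼_ : Algebra.Carrier 𝒜 → Algebra.Carrier 𝒜 → Set r}
         (stable : IsStablePreorder 𝒜 _≼_) where

  open Algebra 𝒜
  open IsStablePreorder stable

  freeze-mono : ∀ ξ i c {x y} → x ≼ y → freeze 𝒜 ξ i c x ≼ freeze 𝒜 ξ i c y
  freeze-mono ξ i c x≼y =
    compat ξ _ _ (updateAt-pointwise _≼_ (λ {x} → refl≼ x) c i x≼y)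

  Freez*-mono : ∀ {γ} → Freez* 𝒜 γ → ∀ {x y} → x ≼ y → γ x ≼ γ y
  Freez*-mono idF              x≼y = x≼y
  Freez*-mono (compF ξ i c γ′) x≼y = freeze-mono ξ i c (Freez*-mono γ′ x≼y)

  IsInitial-preimage : ∀ {X : Pred Carrier ℓ} {γ} → Freez* 𝒜 γ →
                       IsInitial 𝒜 _≼_ X → IsInitial 𝒜 _≼_ (X ∘ γ)
  IsInitial-preimage γ X-initial Xγx y≼x = X-initial Xγx (Freez*-mono γ y≼x)

  Latt∞-initial : ∀ {L : Pred Carrier ℓ} → IsInitial 𝒜 _≼_ L →
                  ∀ {X} → Latt∞ 𝒜 L X → IsInitial 𝒜 _≼_ X
  Latt∞-initial L-initial base = L-initial
  Latt∞-initial L-initial (⋃-cl I F Fs) (i , Fix) y≼x =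
    i , Latt∞-initial L-initial (Fs i) Fix y≼x
  Latt∞-initial L-initial (⋂-cl I F Fs) Fx y≼x i =
    Latt∞-initial L-initial (Fs i) (Fx i) y≼x
  Latt∞-initial L-initial (pre γ X) =
    IsInitial-preimage γ (Latt∞-initial L-initial X)
  Latt∞-initial L-initial (ext X X⊆Y Y⊆X) Yx y≼x =
    X⊆Y _ (Latt∞-initial L-initial X (Y⊆X _ Yx) y≼x)

lemma4p6 : ∀ {a o r ℓ : Level} (𝒜 : Algebra a o)
             (_≼_ : Algebra.Carrier 𝒜 → Algebra.Carrier 𝒜 → Set r) →
             IsStablePreorder 𝒜 _≼_ →
             (L : Pred (Algebra.Carrier 𝒜) ℓ) → IsInitial 𝒜 _≼_ L →
             ∀ X → Latt∞ 𝒜 L X → IsInitial 𝒜 _≼_ X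
lemma4p6 𝒜 _≼_ stable L L-initial X = Latt∞-initial 𝒜 stable L-initial
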